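{- Let $F:\mathcal{C}\rightarrow\mathcal{D}$ be a traced Freyd category (with $\mathcal{D}$ monoidal). Then $F$ is closed if and only if the composite $N\circ F:\mathcal{C}\rightarrow\mathbf{Int}\,\mathcal{D}$ has a right adjoint, where $N:\mathcal{D}\rightarrow\mathbf{Int}\,\mathcal{D}$ is the canonical embedding.
   Context: A Freyd category consists of a cartesian category $\mathcal{C}$ (a category with finite products, regarded as symmetric monoidal via the product), a symmetric monoidal category $\mathcal{D}$ (with tensor $\otimes$ and unit $I$), and an identity-on-objects strict symmetric monoidal functor $F:\mathcal{C}\rightarrow\mathcal{D}$. It is closed if for each object $D$ of $\mathcal{D}$ the functor $F(-)\otimes D:\mathcal{C}\rightarrow\mathcal{D}$ has a right adjoint. It is traced if $\mathcal{D}$ is a traced symmetric monoidal category, i.e. equipped with a family $\mathrm{Tr}^X_{A,B}:\mathcal{D}(A\otimes X,B\otimes X)\rightarrow\mathcal{D}(A,B)$ satisfying the standard Joyal–Street–Verity trace axioms. The Int-construction: $\mathbf{Int}\,\mathcal{D}$ has objects pairs $(X,U)$ of objects of $\mathcal{D}$; morphisms $(X,U)\rightarrow(Y,V)$ are morphisms $X\otimes V\rightarrow Y\otimes U$ of $\mathcal{D}$; composition of $f:(X,U)\rightarrow(Y,V)$ and $g:(Y,V)\rightarrow(Z,W)$ is given by tracing out $V$ from the evident composite built from $f$, $g$ and symmetries; tensor $(X_1,U_1)\otimes(X_2,U_2)=(X_1\otimes X_2,U_2\otimes U_1)$, unit $(I,I)$, dual of $(X,U)$ is $(U,X)$; it is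 compact closed. The canonical embedding $N$ sends $X$ to $(X,I)$ and $f:X\rightarrow Y$ to the corresponding morphism $X\otimes I\rightarrow Y\otimes I$; it is full, faithful and strong symmetric monoidal. -}

module Defs where

open import Level using (Level; _⊔_; suc)
open import Relation.Binary using (Rel; IsEquivalence)
open import Data.Product using (Σ; Σ-syntax; _×_; _,_)

record Category {o : Level} (Obj : Set o) (ℓ e : Level) : Set (o ⊔ suc (ℓ ⊔ e)) where
  infixr 9 _∘_
  infix  4 _≈_
  field
    _⇒_   : Obj → Obj → Set ℓ
    _≈_   : ∀ {A B} → Rel (A ⇒ B) e
    id    : ∀ {A} → A ⇒ A
    _∘_   : ∀ {A B C} → B ⇒ C → A ⇒ B → A ⇒ C
    equiv : ∀ {A B} → IsEquivalence (_≈_ {A} {B})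
    assoc : ∀ {A B C D} {f : A ⇒ B} {g : B ⇒ C} {h : C ⇒ D} →
            (h ∘ g) ∘ f ≈ h ∘ (g ∘ f)
    identityˡ : ∀ {A B} {f : A ⇒ B} → id ∘ f ≈ f
    identityʳ : ∀ {A B} {f : A ⇒ B} → f ∘ id ≈ f
    ∘-resp-≈  : ∀ {A B C} {f h : B ⇒ C} {g i : A ⇒ B} →
                f ≈ h → g ≈ i → f ∘ g ≈ h ∘ i

-- Raw hom-structure (objects, homs, equality of homs, composition);
-- used for Int D, whose category laws are a theorem, not needed to state
-- the existence of a right adjoint.
record RawCategory (o ℓ e : Level) : Set (suc (o ⊔ ℓ ⊔ e)) where
  field
    Obj : Set o
    _⇒_ : Obj → Obj → Set ℓ
    _≈_ : ∀ {A B} → Rel (A ⇒ B) e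
    _∘_ : ∀ {A B C} → B ⇒ C → A ⇒ B → A ⇒ C

record RawFunctor {o ℓ e o' ℓ' e'} {Obj : Set o} (C : Category Obj ℓ e)
                  (E : RawCategory o' ℓ' e') : Set (o ⊔ ℓ ⊔ o' ⊔ ℓ') where
  private module C = Category C
  private module E = RawCategory E
  field
    F₀ : Obj → E.Obj
    F₁ : ∀ {A B} → A C.⇒ B → F₀ A E.⇒ F₀ B

-- G : C → E has a right adjoint: every object E of E has a couniversal
-- arrow from G (Mac Lane, Thm IV.1.2): an object R E of C and a counit
-- ε : G (R E) → E such that every f : G c → E factors uniquely as ε ∘ G g.
HasRightAdjoint : ∀ {o ℓ e o' ℓ' e'} {Obj : Set o} {C : Category Obj ℓ e}
                    {E : RawCategory o' ℓ' e'} → RawFunctor C E →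
                    Set (o ⊔ ℓ ⊔ e ⊔ o' ⊔ ℓ' ⊔ e')
HasRightAdjoint {Obj = Obj} {C = C} {E = E} G =
  (Y : E.Obj) → Σ[ R ∈ Obj ] Σ[ ε ∈ (G.F₀ R E.⇒ Y) ]
    ((c : Obj) (f : G.F₀ c E.⇒ Y) →
       Σ[ g ∈ (c C.⇒ R) ] ((ε E.∘ G.F₁ g) E.≈ f ×
         ((g' : c C.⇒ R) → (ε E.∘ G.F₁ g') E.≈ f → g' C.≈ g)))
  where
  module C = Category C
  module E = RawCategory E
  module G = RawFunctor G

record IdOnObjFunctor {o ℓ e ℓ' e'} {Obj : Set o}
         (C : Category Obj ℓ e) (D : Category Obj ℓ' e') : Set (o ⊔ ℓ ⊔ e ⊔ ℓ' ⊔ e') where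
  private module C = Category C
  private module D = Category D
  field
    F₁ : ∀ {A B} → A C.⇒ B → A D.⇒ B
    identity     : ∀ {A} → F₁ (C.id {A}) D.≈ D.id
    homomorphism : ∀ {A B Z} {f : A C.⇒ B} {g : B C.⇒ Z} →
                   F₁ (g C.∘ f) D.≈ (F₁ g D.∘ F₁ f)
    F-resp-≈     : ∀ {A B} {f g : A C.⇒ B} → f C.≈ g → F₁ f D.≈ F₁ g

record Cartesian {o ℓ e} {Obj : Set o} (C : Category Obj ℓ e) : Set (o ⊔ ℓ ⊔ e) where
  open Category C
  infixr 7 _×ₒ_
  field
    ⊤     : Obj
    !     : ∀ {A} → A ⇒ ⊤
    !-unique : ∀ {A} (f : A ⇒ ⊤) → f ≈ !
    _×ₒ_  : Obj → Obj → Obj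
    π₁    : ∀ {A B} → (A ×ₒ B) ⇒ A
    π₂    : ∀ {A B} → (A ×ₒ B) ⇒ B
    ⟨_,_⟩ : ∀ {A B Z} → Z ⇒ A → Z ⇒ B → Z ⇒ (A ×ₒ B)
    project₁ : ∀ {A B Z} {f : Z ⇒ A} {g : Z ⇒ B} → π₁ ∘ ⟨ f , g ⟩ ≈ f
    project₂ : ∀ {A B Z} {f : Z ⇒ A} {g : Z ⇒ B} → π₂ ∘ ⟨ f , g ⟩ ≈ g
    unique   : ∀ {A B Z} {h : Z ⇒ (A ×ₒ B)} {f : Z ⇒ A} {g : Z ⇒ B} →
               π₁ ∘ h ≈ f → π₂ ∘ h ≈ g → ⟨ f , g ⟩ ≈ h

  _×₁_ : ∀ {A B A' B'} → A ⇒ A' → B ⇒ B' → (A ×ₒ B) ⇒ (A' ×ₒ B')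
  f ×₁ g = ⟨ f ∘ π₁ , g ∘ π₂ ⟩

  αˣ : ∀ {A B Z} → ((A ×ₒ B) ×ₒ Z) ⇒ (A ×ₒ (B ×ₒ Z))
  αˣ = ⟨ π₁ ∘ π₁ , ⟨ π₂ ∘ π₁ , π₂ ⟩ ⟩

  λˣ : ∀ {A} → (⊤ ×ₒ A) ⇒ A
  λˣ = π₂

  ρˣ : ∀ {A} → (A ×ₒ ⊤) ⇒ A
  ρˣ = π₁

  σˣ : ∀ {A B} → (A ×ₒ B) ⇒ (B ×ₒ A)
  σˣ = ⟨ π₂ , π₁ ⟩

record SymmetricMonoidal {o ℓ e} {Obj : Set o} (D : Category Obj ℓ e)
         (_⊗_ : Obj → Obj → Obj) (I : Obj) : Set (o ⊔ ℓ ⊔ e) where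
  open Category D
  infixr 10 _⊗₁_
  field
    _⊗₁_ : ∀ {A B A' B'} → A ⇒ A' → B ⇒ B' → (A ⊗ B) ⇒ (A' ⊗ B')
    ⊗-identity : ∀ {A B} → (id {A} ⊗₁ id {B}) ≈ id
    ⊗-homomorphism : ∀ {A B C A' B' C'} {f : A ⇒ B} {g : B ⇒ C}
                       {f' : A' ⇒ B'} {g' : B' ⇒ C'} →
                     ((g ∘ f) ⊗₁ (g' ∘ f')) ≈ ((g ⊗₁ g') ∘ (f ⊗₁ f'))
    ⊗-resp-≈ : ∀ {A B A' B'} {f g : A ⇒ A'} {f' g' : B ⇒ B'} →
               f ≈ g → f' ≈ g' → (f ⊗₁ f') ≈ (g ⊗₁ g')

    α  : ∀ {A B C} → ((A ⊗ B) ⊗ C) ⇒ (A ⊗ (B ⊗ C))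
    α⁻¹ : ∀ {A B C} → (A ⊗ (B ⊗ C)) ⇒ ((A ⊗ B) ⊗ C)
    λ⇒ : ∀ {A} → (I ⊗ A) ⇒ A
    λ⇐ : ∀ {A} → A ⇒ (I ⊗ A)
    ρ⇒ : ∀ {A} → (A ⊗ I) ⇒ A
    ρ⇐ : ∀ {A} → A ⇒ (A ⊗ I)

    α-isoˡ : ∀ {A B C} → α⁻¹ ∘ α {A} {B} {C} ≈ id
    α-isoʳ : ∀ {A B C} → α ∘ α⁻¹ {A} {B} {C} ≈ id
    λ-isoˡ : ∀ {A} → λ⇐ ∘ λ⇒ {A} ≈ id
    λ-isoʳ : ∀ {A} → λ⇒ ∘ λ⇐ {A} ≈ id
    ρ-isoˡ : ∀ {A} → ρ⇐ ∘ ρ⇒ {A} ≈ id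
    ρ-isoʳ : ∀ {A} → ρ⇒ ∘ ρ⇐ {A} ≈ id

    α-natural : ∀ {A B C A' B' C'} {f : A ⇒ A'} {g : B ⇒ B'} {h : C ⇒ C'} →
                α ∘ ((f ⊗₁ g) ⊗₁ h) ≈ (f ⊗₁ (g ⊗₁ h)) ∘ α
    λ-natural : ∀ {A B} {f : A ⇒ B} → λ⇒ ∘ (id ⊗₁ f) ≈ f ∘ λ⇒
    ρ-natural : ∀ {A B} {f : A ⇒ B} → ρ⇒ ∘ (f ⊗₁ id) ≈ f ∘ ρ⇒

    pentagon : ∀ {A B C D} →
               (id {A} ⊗₁ α {B} {C} {D}) ∘ α ∘ (α ⊗₁ id) ≈ α ∘ α
    triangle : ∀ {A B} → (id {A} ⊗₁ λ⇒ {B}) ∘ α ≈ ρ⇒ ⊗₁ id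

    σ : ∀ {A B} → (A ⊗ B) ⇒ (B ⊗ A)
    σ-natural : ∀ {A B A' B'} {f : A ⇒ A'} {g : B ⇒ B'} →
                σ ∘ (f ⊗₁ g) ≈ (g ⊗₁ f) ∘ σ
    σ-involutive : ∀ {A B} → σ {B} {A} ∘ σ {A} {B} ≈ id
    hexagon : ∀ {A B C} →
              α ∘ σ ∘ α {A} {B} {C} ≈ (id ⊗₁ σ) ∘ α ∘ (σ ⊗₁ id)

-- Traces (Joyal–Street–Verity axioms, in the form of e.g. Selinger's survey)

record Trace {o ℓ e} {Obj : Set o} {D : Category Obj ℓ e}
         {_⊗_ : Obj → Obj → Obj} {I : Obj}
         (M : SymmetricMonoidal D _⊗_ I) : Set (o ⊔ ℓ ⊔ e) where
  open Category D
  open SymmetricMonoidal M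
  field
    Tr : ∀ {X A B} → (A ⊗ X) ⇒ (B ⊗ X) → A ⇒ B
    Tr-resp-≈ : ∀ {X A B} {f g : (A ⊗ X) ⇒ (B ⊗ X)} → f ≈ g → Tr f ≈ Tr g
    tightening : ∀ {X A A' B B'} {h : A' ⇒ A} {f : (A ⊗ X) ⇒ (B ⊗ X)} {g : B ⇒ B'} →
                 Tr ((g ⊗₁ id) ∘ f ∘ (h ⊗₁ id)) ≈ g ∘ Tr f ∘ h
    sliding : ∀ {X Y A B} {f : (A ⊗ X) ⇒ (B ⊗ Y)} {g : Y ⇒ X} →
              Tr {X} ((id ⊗₁ g) ∘ f) ≈ Tr {Y} (f ∘ (id ⊗₁ g))
    vanishing-I : ∀ {A B} {f : (A ⊗ I) ⇒ (B ⊗ I)} → Tr {I} f ≈ ρ⇒ ∘ f ∘ ρ⇐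
    vanishing-⊗ : ∀ {X Y A B} {f : (A ⊗ (X ⊗ Y)) ⇒ (B ⊗ (X ⊗ Y))} →
                  Tr {X ⊗ Y} f ≈ Tr {X} (Tr {Y} (α⁻¹ ∘ f ∘ α))
    superposing : ∀ {X A B C C'} {g : C ⇒ C'} {f : (A ⊗ X) ⇒ (B ⊗ X)} →
                  Tr {X} (α⁻¹ ∘ (g ⊗₁ f) ∘ α) ≈ g ⊗₁ Tr f
    yanking : ∀ {X} → Tr {X} (σ {X} {X}) ≈ id

record TracedFreydCategory (o ℓ e ℓ' e' : Level) : Set (suc (o ⊔ ℓ ⊔ e ⊔ ℓ' ⊔ e')) where
  field
    Obj  : Set o
    C    : Category Obj ℓ e
    cart : Cartesian C
  open Cartesian cart public
  field
    D    : Category Obj ℓ' e'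
    -- D symmetric monoidal; tensor/unit on objects coincide with those of C
    -- since F is identity on objects and strict monoidal
    monD : SymmetricMonoidal D _×ₒ_ ⊤
    trD  : Trace monD
    F    : IdOnObjFunctor C D
  private module D = Category D
  private module M = SymmetricMonoidal monD
  private module F = IdOnObjFunctor F
  field
    F-⊗ : ∀ {A B A' B'} {f : Category._⇒_ C A A'} {g : Category._⇒_ C B B'} →
          F.F₁ (f ×₁ g) D.≈ (F.F₁ f M.⊗₁ F.F₁ g)
    F-α : ∀ {A B Z} → F.F₁ (αˣ {A} {B} {Z}) D.≈ M.α
    F-λ : ∀ {A} → F.F₁ (λˣ {A}) D.≈ M.λ⇒
    F-ρ : ∀ {A} → F.F₁ (ρˣ {A}) D.≈ M.ρ⇒
    F-σ : ∀ {A B} → F.F₁ (σˣ {A} {B}) D.≈ M.σ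

module _ {o ℓ e ℓ' e'} (Fr : TracedFreydCategory o ℓ e ℓ' e') where
  open TracedFreydCategory Fr
  private module D = Category D
  open SymmetricMonoidal monD
  open Trace trD
  private module F = IdOnObjFunctor F

  infixr 7 _⊗_
  _⊗_ : Obj → Obj → Obj
  _⊗_ = _×ₒ_

  I : Obj
  I = ⊤

  rawD : RawCategory o ℓ' e'
  rawD = record { Obj = Obj ; _⇒_ = D._⇒_ ; _≈_ = D._≈_ ; _∘_ = D._∘_ }

  F-⊗ʳ : Obj → RawFunctor C rawD
  F-⊗ʳ Y = record { F₀ = λ A → A ⊗ Y ; F₁ = λ f → F.F₁ f ⊗₁ D.id }

  IsClosed : Set (o ⊔ ℓ ⊔ e ⊔ ℓ' ⊔ e')
  IsClosed = (Y : Obj) → HasRightAdjoint (F-⊗ʳ Y)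

  IntHom : Obj × Obj → Obj × Obj → Set ℓ'
  IntHom (X , U) (Y , V) = (X ⊗ V) D.⇒ (Y ⊗ U)

  Int-∘ : ∀ {P Q R} → IntHom Q R → IntHom P Q → IntHom P R
  Int-∘ {X , U} {Y , V} {Z , W} g f = Tr {V}
    ( α⁻¹ D.∘ (D.id ⊗₁ σ) D.∘ α D.∘ (g ⊗₁ D.id)      -- (Y⊗W)⊗U → (Z⊗U)⊗V
      D.∘ α⁻¹ D.∘ (D.id ⊗₁ σ) D.∘ α D.∘ (f ⊗₁ D.id)  -- (X⊗V)⊗W → (Y⊗W)⊗U
      D.∘ α⁻¹ D.∘ (D.id ⊗₁ σ) D.∘ α )                -- (X⊗W)⊗V → (X⊗V)⊗W

  IntD : RawCategory o ℓ' e'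
  IntD = record
    { Obj = Obj × Obj
    ; _⇒_ = IntHom
    ; _≈_ = D._≈_
    ; _∘_ = λ {P} {Q} {R} g f → Int-∘ {P} {Q} {R} g f
    }

  N₀ : Obj → Obj × Obj
  N₀ X = (X , I)

  N₁ : ∀ {X Y} → X D.⇒ Y → IntHom (N₀ X) (N₀ Y)
  N₁ f = f ⊗₁ D.id

  N∘F : RawFunctor C IntD
  N∘F = record { F₀ = N₀ ; F₁ = λ f → N₁ (F.F₁ f) }

-- A morphism N (F c) = (c , I) → (Y , V) of Int D is a morphism c ⊗ V → Y ⊗ I
-- of D, and since the object traced out in composing it with N (F g) is the
-- unit I, vanishing turns that composite into precomposition with F g ⊗ V, up
-- to an involution of Y ⊗ I. Hence a couniversal arrow from N ∘ F to (Y , V) is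
-- the same as one from F(-) ⊗ V to Y ⊗ I ≅ Y, and couniversality is preserved
-- by postcomposing the counit with an isomorphism.
module Submission where

open import Data.Product using (Σ-syntax; _×_; _,_)
open import Function.Bundles using (_⇔_; mk⇔)
open import Level using (_⊔_)
open import Relation.Binary using (Setoid; IsEquivalence)
import Relation.Binary.Reasoning.Setoid as SetoidReasoning

open import Defs

module HomReasoning {o ℓ e} {Obj : Set o} (D : Category Obj ℓ e) where
  open Category D

  hom-setoid : Obj → Obj → Setoid ℓ e
  hom-setoid A B = record { Carrier = A ⇒ B ; _≈_ = _≈_ ; isEquivalence = equiv }

  module _ {A B : Obj} where
    open IsEquivalence (equiv {A} {B}) public
      using () renaming (refl to ≈-refl; sym to ≈-sym; trans to ≈-trans)
    open SetoidReasoning (hom-setoid A B) public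

  infixr 4 refl⟩∘⟨_
  infixl 5 _⟩∘⟨refl

  refl⟩∘⟨_ : ∀ {A B Z} {f : B ⇒ Z} {g h : A ⇒ B} → g ≈ h → f ∘ g ≈ f ∘ h
  refl⟩∘⟨ p = ∘-resp-≈ ≈-refl p

  _⟩∘⟨refl : ∀ {A B Z} {f g : B ⇒ Z} {h : A ⇒ B} → f ≈ g → f ∘ h ≈ g ∘ h
  p ⟩∘⟨refl = ∘-resp-≈ p ≈-refl

  cancelˡ : ∀ {A B Z} {a : B ⇒ Z} {b : Z ⇒ B} {f : A ⇒ B} →
            b ∘ a ≈ id → b ∘ (a ∘ f) ≈ f
  cancelˡ {a = a} {b} {f} inverse = begin
    b ∘ (a ∘ f)  ≈⟨ assoc ⟨
    (b ∘ a) ∘ f  ≈⟨ inverse ⟩∘⟨refl ⟩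
    id ∘ f       ≈⟨ identityˡ ⟩
    f            ∎

  assoc₃ : ∀ {A B Z W V} {a : W ⇒ V} {b : Z ⇒ W} {c : B ⇒ Z} {d : A ⇒ B} →
           (a ∘ (b ∘ c)) ∘ d ≈ a ∘ (b ∘ (c ∘ d))
  assoc₃ = ≈-trans assoc (refl⟩∘⟨ assoc)

  commute-inverses : ∀ {A B A' B'} {a : A ⇒ A'} {a⁻¹ : A' ⇒ A} {b : B ⇒ B'} {b⁻¹ : B' ⇒ B}
                       {f : A ⇒ B} {g : A' ⇒ B'} →
                     a ∘ a⁻¹ ≈ id → b⁻¹ ∘ b ≈ id → b ∘ f ≈ g ∘ a → f ∘ a⁻¹ ≈ b⁻¹ ∘ g
  commute-inverses {a = a} {a⁻¹} {b} {b⁻¹} {f} {g} a-inverse b-inverse square = begin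
    f ∘ a⁻¹                ≈⟨ cancelˡ b-inverse ⟨
    b⁻¹ ∘ (b ∘ (f ∘ a⁻¹))  ≈⟨ refl⟩∘⟨ assoc ⟨
    b⁻¹ ∘ ((b ∘ f) ∘ a⁻¹)  ≈⟨ refl⟩∘⟨ square ⟩∘⟨refl ⟩
    b⁻¹ ∘ ((g ∘ a) ∘ a⁻¹)  ≈⟨ refl⟩∘⟨ assoc ⟩
    b⁻¹ ∘ (g ∘ (a ∘ a⁻¹))  ≈⟨ refl⟩∘⟨ refl⟩∘⟨ a-inverse ⟩
    b⁻¹ ∘ (g ∘ id)         ≈⟨ refl⟩∘⟨ identityʳ ⟩
    b⁻¹ ∘ g                ∎

module _ {o ℓ e ℓ' e'} {Obj : Set o} (C : Category Obj ℓ e) (D : Category Obj ℓ' e') where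
  private
    module C = Category C
    module D = Category D
  open HomReasoning D

  -- HasRightAdjoint G Y is definitionally Σ R, Σ ε, UniqueFactorisation F₀ (λ g → ε ∘ F₁ g).
  UniqueFactorisation : ∀ {R Y} (G₀ : Obj → Obj) → (∀ {c} → c C.⇒ R → G₀ c D.⇒ Y) →
                        Set (o ⊔ ℓ ⊔ e ⊔ ℓ' ⊔ e')
  UniqueFactorisation {R} {Y} G₀ act = (c : Obj) (f : G₀ c D.⇒ Y) →
    Σ[ g ∈ c C.⇒ R ] (act g D.≈ f × ((g' : c C.⇒ R) → act g' D.≈ f → g' C.≈ g))

  unique-factorisation-∘-iso :
    ∀ {R Y Y'} {G₀ : Obj → Obj}
      {act : ∀ {c} → c C.⇒ R → G₀ c D.⇒ Y} {act' : ∀ {c} → c C.⇒ R → G₀ c D.⇒ Y'}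
      (φ : Y D.⇒ Y') (ψ : Y' D.⇒ Y) → ψ D.∘ φ D.≈ D.id → φ D.∘ ψ D.≈ D.id →
      (∀ {c} (g : c C.⇒ R) → act' g D.≈ φ D.∘ act g) →
      UniqueFactorisation G₀ act → UniqueFactorisation G₀ act'
  unique-factorisation-∘-iso {act = act} {act'} φ ψ ψφ≈id φψ≈id act'≈φ∘act factor c f =
    let g , g-factors , g-unique = factor c (ψ D.∘ f)
    in  g , factors g g-factors , λ g' p → g-unique g' (reflects g' p)
    where
    factors : ∀ g → act g D.≈ ψ D.∘ f → act' g D.≈ f
    factors g p = begin
      act' g           ≈⟨ act'≈φ∘act g ⟩
      φ D.∘ act g      ≈⟨ refl⟩∘⟨ p ⟩
      φ D.∘ (ψ D.∘ f)  ≈⟨ cancelˡ φψ≈id ⟩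
      f                ∎

    reflects : ∀ g → act' g D.≈ f → act g D.≈ ψ D.∘ f
    reflects g p = begin
      act g                ≈⟨ cancelˡ ψφ≈id ⟨
      ψ D.∘ (φ D.∘ act g)  ≈⟨ refl⟩∘⟨ act'≈φ∘act g ⟨
      ψ D.∘ act' g         ≈⟨ refl⟩∘⟨ p ⟩
      ψ D.∘ f              ∎

module SymmetricMonoidalProperties
    {o ℓ e} {Obj : Set o} {D : Category Obj ℓ e} {_⊗_ : Obj → Obj → Obj} {I : Obj}
    (M : SymmetricMonoidal D _⊗_ I) where
  open Category D
  open SymmetricMonoidal M
  open HomReasoning D

  α⁻¹-natural : ∀ {A B Z A' B' Z'} {f : A ⇒ A'} {g : B ⇒ B'} {h : Z ⇒ Z'} →
                α⁻¹ ∘ (f ⊗₁ (g ⊗₁ h)) ≈ ((f ⊗₁ g) ⊗₁ h) ∘ α⁻¹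
  α⁻¹-natural = ≈-sym (commute-inverses α-isoʳ α-isoˡ α-natural)

  ρ⇐-natural : ∀ {A B} {f : A ⇒ B} → (f ⊗₁ id) ∘ ρ⇐ ≈ ρ⇐ ∘ f
  ρ⇐-natural = commute-inverses ρ-isoʳ ρ-isoˡ ρ-natural

  id⊗σ-natural : ∀ {A B Z A' B' Z'} {f : A ⇒ A'} {g : B ⇒ B'} {h : Z ⇒ Z'} →
                 (id ⊗₁ σ) ∘ (f ⊗₁ (g ⊗₁ h)) ≈ (f ⊗₁ (h ⊗₁ g)) ∘ (id ⊗₁ σ)
  id⊗σ-natural {f = f} {g} {h} = begin
    (id ⊗₁ σ) ∘ (f ⊗₁ (g ⊗₁ h))  ≈⟨ ⊗-homomorphism ⟨
    (id ∘ f) ⊗₁ (σ ∘ (g ⊗₁ h))   ≈⟨ ⊗-resp-≈ (≈-trans identityˡ (≈-sym identityʳ)) σ-natural ⟩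
    (f ∘ id) ⊗₁ ((h ⊗₁ g) ∘ σ)   ≈⟨ ⊗-homomorphism ⟩
    (f ⊗₁ (h ⊗₁ g)) ∘ (id ⊗₁ σ)  ∎

  id⊗σ-involutive : ∀ {A B Z} → (id {A} ⊗₁ σ {Z} {B}) ∘ (id ⊗₁ σ {B} {Z}) ≈ id
  id⊗σ-involutive = begin
    (id ⊗₁ σ) ∘ (id ⊗₁ σ)  ≈⟨ ⊗-homomorphism ⟨
    (id ∘ id) ⊗₁ (σ ∘ σ)   ≈⟨ ⊗-resp-≈ identityˡ σ-involutive ⟩
    id ⊗₁ id               ≈⟨ ⊗-identity ⟩
    id                     ∎

  exchange : ∀ {A B Z} → ((A ⊗ B) ⊗ Z) ⇒ ((A ⊗ Z) ⊗ B)
  exchange = α⁻¹ ∘ (id ⊗₁ σ) ∘ α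

  exchange-natural : ∀ {A B Z A' B' Z'} {f : A ⇒ A'} {g : B ⇒ B'} {h : Z ⇒ Z'} →
                     exchange ∘ ((f ⊗₁ g) ⊗₁ h) ≈ ((f ⊗₁ h) ⊗₁ g) ∘ exchange
  exchange-natural {f = f} {g} {h} = begin
    (α⁻¹ ∘ (id ⊗₁ σ) ∘ α) ∘ ((f ⊗₁ g) ⊗₁ h)      ≈⟨ assoc₃ ⟩
    α⁻¹ ∘ (id ⊗₁ σ) ∘ α ∘ ((f ⊗₁ g) ⊗₁ h)        ≈⟨ refl⟩∘⟨ refl⟩∘⟨ α-natural ⟩
    α⁻¹ ∘ (id ⊗₁ σ) ∘ (f ⊗₁ (g ⊗₁ h)) ∘ α        ≈⟨ refl⟩∘⟨ assoc ⟨
    α⁻¹ ∘ ((id ⊗₁ σ) ∘ (f ⊗₁ (g ⊗₁ h))) ∘ α      ≈⟨ refl⟩∘⟨ id⊗σ-natural ⟩∘⟨refl ⟩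
    α⁻¹ ∘ ((f ⊗₁ (h ⊗₁ g)) ∘ (id ⊗₁ σ)) ∘ α      ≈⟨ ≈-trans assoc (refl⟩∘⟨ ≈-sym assoc) ⟨
    (α⁻¹ ∘ (f ⊗₁ (h ⊗₁ g))) ∘ (id ⊗₁ σ) ∘ α      ≈⟨ α⁻¹-natural ⟩∘⟨refl ⟩
    (((f ⊗₁ h) ⊗₁ g) ∘ α⁻¹) ∘ (id ⊗₁ σ) ∘ α      ≈⟨ assoc ⟩
    ((f ⊗₁ h) ⊗₁ g) ∘ α⁻¹ ∘ (id ⊗₁ σ) ∘ α        ∎

  exchange-involutive : ∀ {A B Z} → exchange {A} {Z} {B} ∘ exchange {A} {B} {Z} ≈ id
  exchange-involutive = begin
    (α⁻¹ ∘ (id ⊗₁ σ) ∘ α) ∘ α⁻¹ ∘ (id ⊗₁ σ) ∘ α  ≈⟨ assoc₃ ⟩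
    α⁻¹ ∘ (id ⊗₁ σ) ∘ α ∘ α⁻¹ ∘ (id ⊗₁ σ) ∘ α    ≈⟨ refl⟩∘⟨ refl⟩∘⟨ cancelˡ α-isoʳ ⟩
    α⁻¹ ∘ (id ⊗₁ σ) ∘ (id ⊗₁ σ) ∘ α              ≈⟨ refl⟩∘⟨ cancelˡ id⊗σ-involutive ⟩
    α⁻¹ ∘ α                                      ≈⟨ α-isoˡ ⟩
    id                                           ∎

  -- Swaps the two copies of I in (Y ⊗ I) ⊗ I; coherence would make it the
  -- identity, but being an involution is all that is needed.
  twist : ∀ {Y} → (Y ⊗ I) ⇒ (Y ⊗ I)
  twist = ρ⇒ ∘ exchange ∘ ρ⇐

  twist-involutive : ∀ {Y} → twist {Y} ∘ twist ≈ id
  twist-involutive = begin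
    (ρ⇒ ∘ exchange ∘ ρ⇐) ∘ ρ⇒ ∘ exchange ∘ ρ⇐  ≈⟨ assoc₃ ⟩
    ρ⇒ ∘ exchange ∘ ρ⇐ ∘ ρ⇒ ∘ exchange ∘ ρ⇐    ≈⟨ refl⟩∘⟨ refl⟩∘⟨ cancelˡ ρ-isoˡ ⟩
    ρ⇒ ∘ exchange ∘ exchange ∘ ρ⇐             ≈⟨ refl⟩∘⟨ cancelˡ exchange-involutive ⟩
    ρ⇒ ∘ ρ⇐                                   ≈⟨ ρ-isoʳ ⟩
    id                                        ∎

module _ {o ℓ e ℓ' e'} (Fr : TracedFreydCategory o ℓ e ℓ' e') where
  open TracedFreydCategory Fr
  open Category D
  open SymmetricMonoidal monD
  open Trace trD
  open IdOnObjFunctor F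
  open SymmetricMonoidalProperties monD
  open HomReasoning D

  Int-∘-N₁ : ∀ {A R Y V} (ε : IntHom Fr (R , ⊤) (Y , V)) (h : A ⇒ R) →
             Int-∘ Fr {A , ⊤} {R , ⊤} {Y , V} ε (N₁ Fr h) ≈ twist ∘ ε ∘ (h ⊗₁ id)
  Int-∘-N₁ ε h = begin
    Tr (α⁻¹ ∘ (id ⊗₁ σ) ∘ α ∘ (ε ⊗₁ id) ∘ α⁻¹ ∘ (id ⊗₁ σ) ∘ α ∘ ((h ⊗₁ id) ⊗₁ id)
          ∘ α⁻¹ ∘ (id ⊗₁ σ) ∘ α)                       ≈⟨ Tr-resp-≈ traced-body ⟩
    Tr (exchange ∘ ((ε ∘ (h ⊗₁ id)) ⊗₁ id))            ≈⟨ vanishing-I ⟩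
    ρ⇒ ∘ (exchange ∘ ((ε ∘ (h ⊗₁ id)) ⊗₁ id)) ∘ ρ⇐     ≈⟨ refl⟩∘⟨ assoc ⟩
    ρ⇒ ∘ exchange ∘ ((ε ∘ (h ⊗₁ id)) ⊗₁ id) ∘ ρ⇐       ≈⟨ refl⟩∘⟨ refl⟩∘⟨ ρ⇐-natural ⟩
    ρ⇒ ∘ exchange ∘ ρ⇐ ∘ ε ∘ (h ⊗₁ id)                 ≈⟨ assoc₃ ⟨
    twist ∘ ε ∘ (h ⊗₁ id)                              ∎
    where
    traced-body : α⁻¹ ∘ (id ⊗₁ σ) ∘ α ∘ (ε ⊗₁ id) ∘ α⁻¹ ∘ (id ⊗₁ σ) ∘ α ∘ ((h ⊗₁ id) ⊗₁ id)
                    ∘ α⁻¹ ∘ (id ⊗₁ σ) ∘ α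
                  ≈ exchange ∘ ((ε ∘ (h ⊗₁ id)) ⊗₁ id)
    traced-body = begin
      _                                                       ≈⟨ assoc₃ ⟨
      exchange ∘ (ε ⊗₁ id) ∘ α⁻¹ ∘ (id ⊗₁ σ) ∘ α ∘ ((h ⊗₁ id) ⊗₁ id) ∘ exchange
                                                              ≈⟨ refl⟩∘⟨ refl⟩∘⟨ assoc₃ ⟨
      exchange ∘ (ε ⊗₁ id) ∘ exchange ∘ ((h ⊗₁ id) ⊗₁ id) ∘ exchange
                                                              ≈⟨ refl⟩∘⟨ refl⟩∘⟨ assoc ⟨
      exchange ∘ (ε ⊗₁ id) ∘ (exchange ∘ ((h ⊗₁ id) ⊗₁ id)) ∘ exchange
                                                              ≈⟨ refl⟩∘⟨ refl⟩∘⟨ exchange-natural ⟩∘⟨refl ⟩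
      exchange ∘ (ε ⊗₁ id) ∘ (((h ⊗₁ id) ⊗₁ id) ∘ exchange) ∘ exchange
                                                              ≈⟨ refl⟩∘⟨ refl⟩∘⟨ ≈-trans assoc (refl⟩∘⟨ exchange-involutive) ⟩
      exchange ∘ (ε ⊗₁ id) ∘ ((h ⊗₁ id) ⊗₁ id) ∘ id          ≈⟨ refl⟩∘⟨ refl⟩∘⟨ identityʳ ⟩
      exchange ∘ (ε ⊗₁ id) ∘ ((h ⊗₁ id) ⊗₁ id)               ≈⟨ refl⟩∘⟨ ⊗-homomorphism ⟨
      exchange ∘ ((ε ∘ (h ⊗₁ id)) ⊗₁ (id ∘ id))               ≈⟨ refl⟩∘⟨ ⊗-resp-≈ ≈-refl identityˡ ⟩
      exchange ∘ ((ε ∘ (h ⊗₁ id)) ⊗₁ id)                      ∎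

  closed⇒right-adjoint : IsClosed Fr → HasRightAdjoint (N∘F Fr)
  closed⇒right-adjoint closed (Y , V) =
    let R , ε , factor = closed V (Y ×ₒ ⊤)
    in  R , ε , unique-factorisation-∘-iso C D twist twist twist-involutive twist-involutive
                  (λ g → Int-∘-N₁ ε (F₁ g)) factor

  right-adjoint⇒closed : HasRightAdjoint (N∘F Fr) → IsClosed Fr
  right-adjoint⇒closed right-adjoint V Y =
    let R , ε , factor = right-adjoint (Y , V)
        counit = ρ⇒ ∘ twist ∘ ε
    in  R , counit , unique-factorisation-∘-iso C D ρ⇒ ρ⇐ ρ-isoˡ ρ-isoʳ
                       (λ g → ≈-trans assoc₃ (refl⟩∘⟨ ≈-sym (Int-∘-N₁ ε (F₁ g)))) factor

mainTheorem2 : ∀ {o ℓ e ℓ' e'} (Fr : TracedFreydCategory o ℓ e ℓ' e') →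
                 IsClosed Fr ⇔ HasRightAdjoint (N∘F Fr)
mainTheorem2 Fr = mk⇔ (closed⇒right-adjoint Fr) (right-adjoint⇒closed Fr)
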